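{- Let $p$ be a prime, $n\ge1$, $k<l$ positive integers, $\mathbf c_2\in\mathbb Z_p^n\setminus p\mathbb Z_p^n$, $C=\begin{pmatrix}p^kE_n&O\\O&p^lE_n\end{pmatrix}$ and $\mathbf c=\begin{pmatrix}\mathbf 0\\ \mathbf c_2\end{pmatrix}\in\mathbb Z_p^{2n}$. Then $(C,\mathbf c)\in\tilde\Delta_{p^k}\cdot\tilde\Delta_{p^l}$ and $(C,\mathbf c)\notin\tilde\Delta_{p^l}\cdot\tilde\Delta_{p^k}$.
   Context: $J=\begin{pmatrix}0&E_n\\-E_n&0\end{pmatrix}$, $G=GSp_{2n}(\mathbb Q_p)=\{g:{}^tgJg=\mu(g)J\}$, $\Delta=G\cap M_{2n}(\mathbb Z_p)$, $\mathcal M=\mathbb Z_p^{2n}$ (columns). $\tilde\Delta=\Delta\times\mathcal M$ is the monoid with $(A,\mathbf a)(B,\mathbf b)=(AB,A\mathbf b+\mu(B)\mathbf a)$. For $m\ge1$, $\tilde\Delta_{p^m}=\{(A,\mathbf a)\in\tilde\Delta: v_p(\mu(A))=m\}$, and $X\cdot Y=\{xy:x\in X,y\in Y\}$. -}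

module Defs where

open import Data.Nat as ℕ using (ℕ; zero; suc)
open import Data.Integer as ℤ using (ℤ; +_; _+_; _*_; _-_; -_)
open import Data.Integer.Divisibility.Signed using (_∣_; ∣m∣n⇒∣m+n; ∣m⇒∣-m; ∣n⇒∣m*n; ∣m⇒∣m*n; ∣-refl)
open import Data.Integer.Properties using (*-zeroˡ; +-inverseʳ; +-inverseˡ; +-assoc; +-identityˡ; neg-distrib-+; *-distribˡ-+; *-distribʳ-+; neg-distribʳ-*; neg-distribˡ-*; +-commutativeSemigroup)
open import Algebra.Properties.CommutativeSemigroup +-commutativeSemigroup using (interchange)
open import Data.Fin using (Fin; zero; suc; splitAt)
open import Data.Fin.Properties using (_≟_)
open import Data.Sum using (_⊎_; inj₁; inj₂)
open import Data.Product using (Σ; ∃; _×_; _,_)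
open import Relation.Nullary using (¬_; yes; no)
open import Relation.Binary.PropositionalEquality using (_≡_; refl; subst; sym; trans; cong; cong₂; module ≡-Reasoning)

-- The p-adic integers ℤ_p as the inverse limit of ℤ/p^m ℤ:
-- an element is a sequence of integer representatives x_m (of the class
-- of x mod p^m) with x_{m+1} ≡ x_m (mod p^m); two elements are equal iff
-- x_m ≡ y_m (mod p^m) for every m.

pow : ℕ → ℕ → ℤ
pow p m = + (p ℕ.^ m)

record ℤp (p : ℕ) : Set where
  constructor mkℤp
  field
    seq : ℕ → ℤ
    coh : ∀ m → pow p m ∣ (seq (suc m) - seq m)
open ℤp public

module _ {p : ℕ} where

  infix 4 _≈_
  _≈_ : ℤp p → ℤp p → Set
  x ≈ y = ∀ m → pow p m ∣ (seq x m - seq y m)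

  ι : ℤ → ℤp p
  ι z = mkℤp (λ _ → z) (λ m → subst (pow p m ∣_) (lem z (pow p m)) (∣n⇒∣m*n (+ 0) {pow p m} ∣-refl))
    where
    lem : ∀ z q → + 0 * q ≡ z - z
    lem z q = trans (*-zeroˡ q) (sym (+-inverseʳ z))

  0p 1p : ℤp p
  0p = ι (+ 0)
  1p = ι (+ 1)

  infixl 6 _+p_
  infixl 7 _*p_
  _+p_ : ℤp p → ℤp p → ℤp p
  x +p y = mkℤp (λ m → seq x m + seq y m)
    (λ m → subst (pow p m ∣_) (eq (seq x (suc m)) (seq x m) (seq y (suc m)) (seq y m))
                 (∣m∣n⇒∣m+n (coh x m) (coh y m)))
    where
    eq : ∀ a b c d → (a - b) + (c - d) ≡ (a + c) - (b + d)
    eq a b c d = trans (interchange a (- b) c (- d)) (cong (λ u → (a + c) + u) (sym (neg-distrib-+ b d)))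

  -p_ : ℤp p → ℤp p
  -p x = mkℤp (λ m → - seq x m)
    (λ m → subst (pow p m ∣_) (eq (seq x (suc m)) (seq x m)) (∣m⇒∣-m (coh x m)))
    where
    eq : ∀ a b → - (a - b) ≡ (- a) - (- b)
    eq a b = neg-distrib-+ a (- b)

  _*p_ : ℤp p → ℤp p → ℤp p
  x *p y = mkℤp (λ m → seq x m * seq y m)
    (λ m → subst (pow p m ∣_) (eq (seq x (suc m)) (seq x m) (seq y (suc m)) (seq y m))
                 (∣m∣n⇒∣m+n (∣n⇒∣m*n (seq x (suc m)) (coh y m)) (∣m⇒∣m*n (seq y m) (coh x m))))
    where
    eq : ∀ a b c d → a * (c - d) + (a - b) * d ≡ a * c - b * d
    eq a b c d = begin
        a * (c - d) + (a - b) * d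
          ≡⟨ cong₂ _+_ (*-distribˡ-+ a c (- d)) (*-distribʳ-+ d a (- b)) ⟩
        (a * c + a * (- d)) + (a * d + (- b) * d)
          ≡⟨ cong₂ (λ u v → (a * c + u) + (a * d + v)) (sym (neg-distribʳ-* a d)) (sym (neg-distribˡ-* b d)) ⟩
        (a * c + - (a * d)) + (a * d + - (b * d))
          ≡⟨ +-assoc (a * c) (- (a * d)) (a * d + - (b * d)) ⟩
        a * c + (- (a * d) + (a * d + - (b * d)))
          ≡⟨ cong (λ u → a * c + u) (sym (+-assoc (- (a * d)) (a * d) (- (b * d)))) ⟩
        a * c + ((- (a * d) + a * d) + - (b * d))
          ≡⟨ cong (λ u → a * c + (u + - (b * d))) (+-inverseˡ (a * d)) ⟩
        a * c + (+ 0 + - (b * d))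
          ≡⟨ cong (λ u → a * c + u) (+-identityˡ (- (b * d))) ⟩
        a * c - b * d ∎
      where open ≡-Reasoning

  p^ : ℕ → ℤp p
  p^ m = ι (pow p m)

  _∈p^_ℤp : ℤp p → ℕ → Set
  x ∈p^ m ℤp = ∃ λ u → x ≈ p^ m *p u

  HasVal : ℤp p → ℕ → Set
  HasVal x m = (x ∈p^ m ℤp) × ¬ (x ∈p^ suc m ℤp)

Mat : ℕ → ℕ → Set
Mat p d = Fin d → Fin d → ℤp p

Col : ℕ → ℕ → Set
Col p d = Fin d → ℤp p

module _ {p : ℕ} where

  Σp : ∀ {d} → (Fin d → ℤp p) → ℤp p
  Σp {zero} f = 0p
  Σp {suc d} f = f zero +p Σp (λ i → f (suc i))

  _·M_ : ∀ {d} → Mat p d → Mat p d → Mat p d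
  (A ·M B) i j = Σp (λ k → A i k *p B k j)

  _·v_ : ∀ {d} → Mat p d → Col p d → Col p d
  (A ·v b) i = Σp (λ k → A i k *p b k)

  _⋆v_ : ∀ {d} → ℤp p → Col p d → Col p d
  (c ⋆v a) i = c *p a i

  _+v_ : ∀ {d} → Col p d → Col p d → Col p d
  (a +v b) i = a i +p b i

  _ᵀ : ∀ {d} → Mat p d → Mat p d
  (A ᵀ) i j = A j i

  _⋆M_ : ∀ {d} → ℤp p → Mat p d → Mat p d
  (c ⋆M A) i j = c *p A i j

  _≈M_ : ∀ {d} → Mat p d → Mat p d → Set
  A ≈M B = ∀ i j → A i j ≈ B i j

  _≈v_ : ∀ {d} → Col p d → Col p d → Set
  a ≈v b = ∀ i → a i ≈ b i

  J : (n : ℕ) → Mat p (n ℕ.+ n)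
  J n i j with splitAt n i | splitAt n j
  ... | inj₁ a | inj₂ b with a ≟ b
  ...   | yes _ = 1p
  ...   | no  _ = 0p
  J n i j | inj₂ a | inj₁ b with a ≟ b
  ...   | yes _ = -p 1p
  ...   | no  _ = 0p
  J n i j | _ | _ = 0p

-- Elements of Δ̃_{p^m}: (A, a) with A ∈ Δ = GSp_{2n}(ℚ_p) ∩ M_{2n}(ℤ_p),
-- v_p(μ(A)) = m, a ∈ ℤ_p^{2n}.  The multiplier μ(A) is recorded together
-- with the witnessing identity ᵗA J A = μ J (it is uniquely determined by A,
-- and lies in ℤ_p since ᵗA J A is integral).  v_p(μ) = m < ∞ forces μ ≠ 0,
-- hence A is invertible, so A ∈ GSp_{2n}(ℚ_p).

record Δ̃ (p n m : ℕ) : Set where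
  constructor mkΔ̃
  field
    mat   : Mat p (n ℕ.+ n)
    mult  : ℤp p
    vec   : Col p (n ℕ.+ n)
    sympl : ((mat ᵀ) ·M (J n ·M mat)) ≈M (mult ⋆M J n)
    val   : HasVal mult m
open Δ̃ public

prodMat : ∀ {p n k l} → Δ̃ p n k → Δ̃ p n l → Mat p (n ℕ.+ n)
prodMat x y = mat x ·M mat y

prodVec : ∀ {p n k l} → Δ̃ p n k → Δ̃ p n l → Col p (n ℕ.+ n)
prodVec x y = (mat x ·v vec y) +v (mult y ⋆v vec x)

InProd : (p n k l : ℕ) → Mat p (n ℕ.+ n) → Col p (n ℕ.+ n) → Set
InProd p n k l C c =
  Σ (Δ̃ p n k) λ x → Σ (Δ̃ p n l) λ y → (prodMat x y ≈M C) × (prodVec x y ≈v c)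

diagC : (p n k l : ℕ) → Mat p (n ℕ.+ n)
diagC p n k l i j with splitAt n i | splitAt n j
... | inj₁ a | inj₁ b with a ≟ b
...   | yes _ = p^ k
...   | no  _ = 0p
diagC p n k l i j | inj₂ a | inj₂ b with a ≟ b
...   | yes _ = p^ l
...   | no  _ = 0p
diagC p n k l i j | _ | _ = 0p

colC : (p n : ℕ) → Col p n → Col p (n ℕ.+ n)
colC p n c₂ i with splitAt n i
... | inj₁ _ = 0p
... | inj₂ b = c₂ b

-- (C, c) factors as (diag(p^k E, E), 0) · (diag(E, p^l E), c).  Conversely,
-- let (C, c) = (A, a)(B, b) with v_p(μ(A)) = l > k and v_p(μ(B)) = k ≥ 1, and
-- reduce the integer representatives modulo p^(k+1).  There ᵗA J A = μ(A) J
-- vanishes, hence so does ᵗA J C = (ᵗA J A) B.  The first n columns of ᵗA J C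
-- are −p^k times the transposed lower n rows of A, so those rows are divisible
-- by p.  Since p ∣ μ(B) too, the lower half c₂ of c = A b + μ(B) a is divisible
-- by p, i.e. c₂ ∈ p ℤ_p^n.

module Submission where

open import Defs
open import Data.Nat as ℕ using (ℕ; zero; suc; _≤_; _<_; NonZero)
import Data.Nat.Properties as ℕP
open import Data.Nat.Divisibility using (∣⇒≤)
open import Data.Nat.Primality using (Prime; prime⇒nonZero; prime⇒nonTrivial)
open import Data.Integer using (ℤ; +_; 0ℤ; _+_; _*_; _-_; -_)
import Data.Integer.Properties as ℤP
open import Data.Integer.Divisibility.Signed
open import Data.Integer.Tactic.RingSolver using (solve-∀)
open import Algebra.Properties.Semiring.Sum ℤP.+-*-semiring
  using (sum; sum-syntax; sum-cong-≗; sum-remove; sum-replicate-zero; ∑-comm;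
         *-distribˡ-sum; *-distribʳ-sum)
open import Function using (_∘′_)
open import Data.Fin using (Fin; zero; suc; punchIn; splitAt; join; _↑ˡ_; _↑ʳ_)
open import Data.Fin.Properties using (punchInᵢ≢i; _≟_; splitAt-↑ˡ; splitAt-↑ʳ; join-splitAt)
open import Data.Sum using (inj₁; inj₂)
open import Data.Product using (_×_; _,_; proj₁)
open import Relation.Nullary using (¬_; yes; no; contradiction)
open import Relation.Binary.PropositionalEquality
  using (_≡_; _≢_; refl; sym; trans; cong; cong₂; subst; subst₂; module ≡-Reasoning)

sum-δ : ∀ {d} (f : Fin d → ℤ) i → (∀ j → j ≢ i → f j ≡ 0ℤ) → sum f ≡ f i
sum-δ {suc d} f i off = begin
  sum f                      ≡⟨ sum-remove {i = i} f ⟩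
  f i + sum (f ∘′ punchIn i) ≡⟨ cong (λ s → f i + s) rest≡0 ⟩
  f i + 0ℤ                   ≡⟨ ℤP.+-identityʳ (f i) ⟩
  f i                        ∎
  where
  open ≡-Reasoning
  rest≡0 : sum (f ∘′ punchIn i) ≡ 0ℤ
  rest≡0 = trans (sum-cong-≗ (λ j → off (punchIn i j) (punchInᵢ≢i i j))) (sum-replicate-zero d)

∣-sum : ∀ {N d} {f : Fin d → ℤ} → (∀ i → N ∣ f i) → N ∣ sum f
∣-sum {d = zero}  _   = divides 0ℤ refl
∣-sum {d = suc d} N∣f = ∣m∣n⇒∣m+n (N∣f zero) (∣-sum (λ i → N∣f (suc i)))

infix 4 _≡_mod_
record _≡_mod_ (x y N : ℤ) : Set where
  constructor congruent
  field difference : N ∣ x - y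

module _ {N : ℤ} where

  ≡⇒≡mod : ∀ {x y} → x ≡ y → x ≡ y mod N
  ≡⇒≡mod {x} refl = congruent (subst (N ∣_) (sym (ℤP.+-inverseʳ x)) (divides 0ℤ refl))

  ≡mod-sym : ∀ {x y} → x ≡ y mod N → y ≡ x mod N
  ≡mod-sym {x} {y} (congruent N∣x-y) = congruent (subst (N ∣_) (negate x y) (∣m⇒∣-m N∣x-y))
    where
    negate : ∀ x y → - (x - y) ≡ y - x
    negate = solve-∀

  ≡mod-trans : ∀ {x y z} → x ≡ y mod N → y ≡ z mod N → x ≡ z mod N
  ≡mod-trans {x} {y} {z} (congruent N∣x-y) (congruent N∣y-z) =
    congruent (subst (N ∣_) (telescope x y z) (∣m∣n⇒∣m+n N∣x-y N∣y-z))
    where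
    telescope : ∀ x y z → (x - y) + (y - z) ≡ x - z
    telescope = solve-∀

  +-cong-mod : ∀ {x x′ y y′} → x ≡ x′ mod N → y ≡ y′ mod N → x + y ≡ x′ + y′ mod N
  +-cong-mod {x} {x′} {y} {y′} (congruent N∣x-x′) (congruent N∣y-y′) =
    congruent (subst (N ∣_) (regroup x x′ y y′) (∣m∣n⇒∣m+n N∣x-x′ N∣y-y′))
    where
    regroup : ∀ x x′ y y′ → (x - x′) + (y - y′) ≡ (x + y) - (x′ + y′)
    regroup = solve-∀

  *-cong-mod : ∀ {x x′ y y′} → x ≡ x′ mod N → y ≡ y′ mod N → x * y ≡ x′ * y′ mod N
  *-cong-mod {x} {x′} {y} {y′} (congruent N∣x-x′) (congruent N∣y-y′) =
    congruent (subst (N ∣_) (regroup x x′ y y′)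
                     (∣m∣n⇒∣m+n (∣n⇒∣m*n x N∣y-y′) (∣m⇒∣m*n y′ N∣x-x′)))
    where
    regroup : ∀ x x′ y y′ → x * (y - y′) + (x - x′) * y′ ≡ x * y - x′ * y′
    regroup = solve-∀

  sum-cong-mod : ∀ {d} {f g : Fin d → ℤ} → (∀ i → f i ≡ g i mod N) → sum f ≡ sum g mod N
  sum-cong-mod {zero}  _   = congruent (divides 0ℤ refl)
  sum-cong-mod {suc d} f≡g = +-cong-mod (f≡g zero) (sum-cong-mod (λ i → f≡g (suc i)))

  ≡mod-weaken : ∀ {M x y} → M ∣ N → x ≡ y mod N → x ≡ y mod M
  ≡mod-weaken M∣N (congruent N∣x-y) = congruent (∣-trans M∣N N∣x-y)

  ∣-resp-≡mod : ∀ {x y} → x ≡ y mod N → N ∣ y → N ∣ x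
  ∣-resp-≡mod {x} {y} (congruent N∣x-y) N∣y =
    subst (N ∣_) (cancel x y) (∣m∣n⇒∣m+n N∣x-y N∣y)
    where
    cancel : ∀ x y → (x - y) + y ≡ x
    cancel = solve-∀

Matℤ : ℕ → Set
Matℤ d = Fin d → Fin d → ℤ

infixl 7 _⊙_
_⊙_ : ∀ {d} → Matℤ d → Matℤ d → Matℤ d
_⊙_ {d} A B i j = ∑[ t < d ] (A i t * B t j)

⊙-assoc : ∀ {d} (A B C : Matℤ d) i j → ((A ⊙ B) ⊙ C) i j ≡ (A ⊙ (B ⊙ C)) i j
⊙-assoc {d} A B C i j = begin
  ∑[ t < d ] (∑[ s < d ] (A i s * B s t) * C t j)
    ≡⟨ sum-cong-≗ (λ t → *-distribʳ-sum (C t j) (λ s → A i s * B s t)) ⟩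
  ∑[ t < d ] ∑[ s < d ] (A i s * B s t * C t j)
    ≡⟨ ∑-comm (λ t s → A i s * B s t * C t j) ⟩
  ∑[ s < d ] ∑[ t < d ] (A i s * B s t * C t j)
    ≡⟨ sum-cong-≗ (λ s → sum-cong-≗ (λ t → ℤP.*-assoc (A i s) (B s t) (C t j))) ⟩
  ∑[ s < d ] ∑[ t < d ] (A i s * (B s t * C t j))
    ≡⟨ sum-cong-≗ (λ s → *-distribˡ-sum (A i s) (λ t → B s t * C t j)) ⟨
  ∑[ s < d ] (A i s * ∑[ t < d ] (B s t * C t j))
    ∎
  where open ≡-Reasoning

⊙-congʳ-mod : ∀ {N d} (A : Matℤ d) {B B′ : Matℤ d} →
  (∀ i j → B i j ≡ B′ i j mod N) → ∀ i j → (A ⊙ B) i j ≡ (A ⊙ B′) i j mod N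
⊙-congʳ-mod A B≡B′ i j =
  sum-cong-mod (λ t → *-cong-mod (≡⇒≡mod {x = A i t} refl) (B≡B′ t j))

⊙-sparseʳ : ∀ {d} (A B : Matℤ d) {s j} → (∀ t → t ≢ s → B t j ≡ 0ℤ) →
  ∀ i → (A ⊙ B) i j ≡ A i s * B s j
⊙-sparseʳ A B {s} {j} off i =
  sum-δ _ s (λ t t≢s → trans (cong (A i t *_) (off t t≢s)) (ℤP.*-zeroʳ (A i t)))

⊙-sparseˡ : ∀ {d} (A B : Matℤ d) {i s} → (∀ t → t ≢ s → A i t ≡ 0ℤ) →
  ∀ j → (A ⊙ B) i j ≡ A i s * B s j
⊙-sparseˡ A B {i} {s} off j =
  sum-δ _ s (λ t t≢s → trans (cong (_* B t j) (off t t≢s)) (ℤP.*-zeroˡ (B t j)))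

_ᵀℤ : ∀ {d} → Matℤ d → Matℤ d
(A ᵀℤ) i j = A j i

IsDiagonal : ∀ {d} → Matℤ d → Set
IsDiagonal {d} D = (i j : Fin d) → i ≢ j → D i j ≡ 0ℤ

ᵀℤ-diagonal : ∀ {d} {D : Matℤ d} → IsDiagonal D → IsDiagonal (D ᵀℤ)
ᵀℤ-diagonal D-diag i j i≢j = D-diag j i (i≢j ∘′ sym)

⊙-diagonalˡ : ∀ {d} {D : Matℤ d} → IsDiagonal D → ∀ E i j → (D ⊙ E) i j ≡ D i i * E i j
⊙-diagonalˡ {D = D} D-diag E i j = ⊙-sparseˡ D E (λ t t≢i → D-diag i t (t≢i ∘′ sym)) j

⊙-diagonalʳ : ∀ {d} {D : Matℤ d} → IsDiagonal D → ∀ E i j → (E ⊙ D) i j ≡ E i j * D j j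
⊙-diagonalʳ {D = D} D-diag E i j = ⊙-sparseʳ E D (λ t t≢j → D-diag t j t≢j) i

module _ {p : ℕ} where

  infix 8 _at_
  _at_ : ∀ {d} → Mat p d → ℕ → Matℤ d
  (A at m) i j = seq (A i j) m

  seq-Σp : ∀ {d} (f : Fin d → ℤp p) m → seq (Σp f) m ≡ ∑[ i < d ] seq (f i) m
  seq-Σp {zero}  f m = refl
  seq-Σp {suc d} f m = cong (λ s → seq (f zero) m + s) (seq-Σp (λ i → f (suc i)) m)

  ·M-at : ∀ {d} (A B : Mat p d) m i j → ((A ·M B) at m) i j ≡ (A at m ⊙ B at m) i j
  ·M-at A B m i j = seq-Σp (λ t → A i t *p B t j) m

  ᵀ·M·M-at : ∀ {d} (A B C : Mat p d) m i j →
    (((A ᵀ) ·M (B ·M C)) at m) i j ≡ ((A at m) ᵀℤ ⊙ (B at m ⊙ C at m)) i j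
  ᵀ·M·M-at A B C m i j = trans (seq-Σp (λ s → A s i *p (B ·M C) s j) m)
    (sum-cong-≗ (λ s → cong (seq (A s i) m *_) (·M-at B C m s j)))

  cong-seq : ∀ {x y : ℤp p} m → x ≡ y → seq x m ≡ seq y m
  cong-seq m = cong (λ z → seq z m)

  ≈-from-seq : {x y : ℤp p} → (∀ m → seq x m ≡ seq y m) → x ≈ y
  ≈-from-seq x≡y m = _≡_mod_.difference (≡⇒≡mod (x≡y m))

  pow-+ : ∀ i j → pow p (i ℕ.+ j) ≡ pow p i * pow p j
  pow-+ i j = trans (cong +_ (ℕP.^-distribˡ-+-* p i j)) (ℤP.pos-* (p ℕ.^ i) (p ℕ.^ j))

  pow-suc : ∀ m → pow p (suc m) ≡ pow p m * + p
  pow-suc m = trans (ℤP.pos-* p (p ℕ.^ m)) (ℤP.*-comm (+ p) (pow p m))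

  pow-∣ : ∀ {i j} → i ≤ j → pow p i ∣ pow p j
  pow-∣ {i} {j} i≤j = divides (pow p (j ℕ.∸ i)) (begin
    pow p j                       ≡⟨ cong (pow p) (ℕP.m+[n∸m]≡n i≤j) ⟨
    pow p (i ℕ.+ (j ℕ.∸ i))       ≡⟨ pow-+ i (j ℕ.∸ i) ⟩
    pow p i * pow p (j ℕ.∸ i)     ≡⟨ ℤP.*-comm (pow p i) _ ⟩
    pow p (j ℕ.∸ i) * pow p i     ∎)
    where open ≡-Reasoning

  ∈p^⇒∣ : ∀ {x : ℤp p} {i j} m → x ∈p^ j ℤp → i ≤ j → i ≤ m → pow p i ∣ seq x m
  ∈p^⇒∣ m (u , x≈p^ju) i≤j i≤m =
    ∣-resp-≡mod (congruent (∣-trans (pow-∣ i≤m) (x≈p^ju m)))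
                (∣-trans (pow-∣ i≤j) (∣m⇒∣m*n (seq u m) ∣-refl))

  p^-hasVal : .{{_ : ℕ.NonTrivial p}} → ∀ k → HasVal (p^ k) k
  p^-hasVal k = (1p , p^k≈p^k·1) , p^k∉p^k+1
    where
    p^k≈p^k·1 : p^ k ≈ p^ k *p 1p
    p^k≈p^k·1 = ≈-from-seq {x = p^ k} {y = p^ k *p 1p} (λ m → sym (ℤP.*-identityʳ (pow p k)))
    p^k∉p^k+1 : ¬ (p^ k ∈p^ suc k ℤp)
    p^k∉p^k+1 p^k∈ = ℕP.<⇒≱ (ℕP.^-monoʳ-< p (ℕ.nonTrivial⇒n>1 p) (ℕP.n<1+n k))
      (∣⇒≤ {{ℕP.m^n≢0 p k {{ℕ.nonTrivial⇒nonZero p}}}}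
        (∣⇒∣ᵤ (∈p^⇒∣ {x = p^ k} (suc k) p^k∈ ℕP.≤-refl ℕP.≤-refl)))

  seq-suc-≡mod-p : (z : ℤp p) → ∀ m → seq z (suc (suc m)) ≡ seq z (suc m) mod + p
  seq-suc-≡mod-p z m = congruent (∣-trans (divides (pow p m) (pow-suc m)) (coh z (suc m)))

  p∣seq-suc⇒p∣seq-1 : (z : ℤp p) → ∀ m → + p ∣ seq z (suc m) → + p ∣ seq z 1
  p∣seq-suc⇒p∣seq-1 z zero    p∣z = p∣z
  p∣seq-suc⇒p∣seq-1 z (suc m) p∣z =
    p∣seq-suc⇒p∣seq-1 z m (∣-resp-≡mod (≡mod-sym (seq-suc-≡mod-p z m)) p∣z)

  p∣seq-1⇒p∣seq-suc : (z : ℤp p) → + p ∣ seq z 1 → ∀ m → + p ∣ seq z (suc m)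
  p∣seq-1⇒p∣seq-suc z p∣z zero    = p∣z
  p∣seq-1⇒p∣seq-suc z p∣z (suc m) =
    ∣-resp-≡mod (seq-suc-≡mod-p z m) (p∣seq-1⇒p∣seq-suc z p∣z m)

  -- z = p u, where u_m is the exact quotient z_{m+1} / p.
  ∈pℤp-intro : .{{_ : NonZero p}} (z : ℤp p) → (∀ m → + p ∣ seq z (suc m)) → z ∈p^ 1 ℤp
  ∈pℤp-intro z p∣z = u , z≈pu
    where
    u-seq : ℕ → ℤ
    u-seq m = quotient (p∣z m)
    z≡up : ∀ m → seq z (suc m) ≡ u-seq m * + p
    z≡up m = _∣_.equality (p∣z m)
    u-coh : ∀ m → pow p m ∣ u-seq (suc m) - u-seq m
    u-coh m = *-cancelʳ-∣ (+ p) (subst₂ _∣_ (pow-suc m) (begin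
      seq z (suc (suc m)) - seq z (suc m)        ≡⟨ cong₂ _-_ (z≡up (suc m)) (z≡up m) ⟩
      u-seq (suc m) * + p - u-seq m * + p        ≡⟨ factor (u-seq (suc m)) (u-seq m) (+ p) ⟩
      (u-seq (suc m) - u-seq m) * + p            ∎) (coh z (suc m)))
      where
      open ≡-Reasoning
      factor : ∀ a b c → a * c - b * c ≡ (a - b) * c
      factor = solve-∀
    u : ℤp p
    u = mkℤp u-seq u-coh
    p·u≡z : ∀ m → seq (p^ 1 *p u) m ≡ seq z (suc m)
    p·u≡z m = begin
      + (p ℕ.* 1) * u-seq m   ≡⟨ cong (λ q → + q * u-seq m) (ℕP.*-identityʳ p) ⟩
      + p * u-seq m           ≡⟨ ℤP.*-comm (+ p) (u-seq m) ⟩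
      u-seq m * + p           ≡⟨ z≡up m ⟨
      seq z (suc m)           ∎
      where open ≡-Reasoning
    z≈pu : z ≈ p^ 1 *p u
    z≈pu m = subst (λ v → pow p m ∣ seq z m - v) (sym (p·u≡z m))
      (_≡_mod_.difference (≡mod-sym {x = seq z (suc m)} (congruent (coh z m))))

  ∈pℤp-from-level : .{{_ : NonZero p}} (z : ℤp p) (m : ℕ) → + p ∣ seq z (suc m) → z ∈p^ 1 ℤp
  ∈pℤp-from-level z m p∣z =
    ∈pℤp-intro z (p∣seq-1⇒p∣seq-suc z (p∣seq-suc⇒p∣seq-1 z m p∣z))

data Half (n : ℕ) : Fin (n ℕ.+ n) → Set where
  upper : (a : Fin n) → Half n (a ↑ˡ n)
  lower : (a : Fin n) → Half n (n ↑ʳ a)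

half : ∀ n i → Half n i
half n i = subst (Half n) (join-splitAt n n i) (fromSplit (splitAt n i))
  where
  fromSplit : ∀ s → Half n (join n n s)
  fromSplit (inj₁ a) = upper a
  fromSplit (inj₂ a) = lower a

module _ {p n : ℕ} where

  J-upper-upper : ∀ a b → J {p} n (a ↑ˡ n) (b ↑ˡ n) ≡ 0p
  J-upper-upper a b rewrite splitAt-↑ˡ n a n | splitAt-↑ˡ n b n = refl

  J-lower-lower : ∀ a b → J {p} n (n ↑ʳ a) (n ↑ʳ b) ≡ 0p
  J-lower-lower a b rewrite splitAt-↑ʳ n n a | splitAt-↑ʳ n n b = refl

  J-lower-upper : ∀ a → J {p} n (n ↑ʳ a) (a ↑ˡ n) ≡ -p 1p
  J-lower-upper a rewrite splitAt-↑ʳ n n a | splitAt-↑ˡ n a n with a ≟ a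
  ... | yes _   = refl
  ... | no  a≢a = contradiction refl a≢a

  J-column-upper : ∀ b s → s ≢ n ↑ʳ b → J {p} n s (b ↑ˡ n) ≡ 0p
  J-column-upper b s s≢ with half n s
  ... | upper a = J-upper-upper a b
  ... | lower a rewrite splitAt-↑ʳ n n a | splitAt-↑ˡ n b n with a ≟ b
  ...   | yes refl = contradiction refl s≢
  ...   | no  _    = refl

  module _ (k l : ℕ) where

    diagC-upper : ∀ a → diagC p n k l (a ↑ˡ n) (a ↑ˡ n) ≡ p^ k
    diagC-upper a rewrite splitAt-↑ˡ n a n with a ≟ a
    ... | yes _   = refl
    ... | no  a≢a = contradiction refl a≢a

    diagC-lower : ∀ a → diagC p n k l (n ↑ʳ a) (n ↑ʳ a) ≡ p^ l
    diagC-lower a rewrite splitAt-↑ʳ n n a with a ≟ a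
    ... | yes _   = refl
    ... | no  a≢a = contradiction refl a≢a

    diagC-offDiagonal : ∀ i j → i ≢ j → diagC p n k l i j ≡ 0p
    diagC-offDiagonal i j i≢j with half n i | half n j
    ... | upper a | lower b rewrite splitAt-↑ˡ n a n | splitAt-↑ʳ n n b = refl
    ... | lower a | upper b rewrite splitAt-↑ʳ n n a | splitAt-↑ˡ n b n = refl
    ... | upper a | upper b rewrite splitAt-↑ˡ n a n | splitAt-↑ˡ n b n with a ≟ b
    ...   | yes refl = contradiction refl i≢j
    ...   | no  _    = refl
    diagC-offDiagonal i j i≢j | lower a | lower b
      rewrite splitAt-↑ʳ n n a | splitAt-↑ʳ n n b with a ≟ b
    ...   | yes refl = contradiction refl i≢j
    ...   | no  _    = refl

  colC-upper : ∀ (c₂ : Col p n) a → colC p n c₂ (a ↑ˡ n) ≡ 0p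
  colC-upper c₂ a rewrite splitAt-↑ˡ n a n = refl

  colC-lower : ∀ (c₂ : Col p n) a → colC p n c₂ (n ↑ʳ a) ≡ c₂ a
  colC-lower c₂ a rewrite splitAt-↑ʳ n n a = refl

  diagC-at-diagonal : ∀ k l m → IsDiagonal (diagC p n k l at m)
  diagC-at-diagonal k l m i j i≢j = cong-seq m (diagC-offDiagonal k l i j i≢j)

  diagC-product : ∀ k l → (diagC p n k 0 ·M diagC p n 0 l) ≈M diagC p n k l
  diagC-product k l i j = ≈-from-seq {x = (diagC p n k 0 ·M diagC p n 0 l) i j} {y = diagC p n k l i j}
    (λ m → trans (·M-at (diagC p n k 0) (diagC p n 0 l) m i j)
             (trans (⊙-diagonalˡ (diagC-at-diagonal k 0 m) (diagC p n 0 l at m) i j) (entry m)))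
    where
    entry : ∀ m → seq (diagC p n k 0 i i) m * seq (diagC p n 0 l i j) m ≡ seq (diagC p n k l i j) m
    entry m with i ≟ j
    ... | no i≢j =
      trans (cong (seq (diagC p n k 0 i i) m *_) (cong-seq m (diagC-offDiagonal 0 l i j i≢j)))
      (trans (ℤP.*-zeroʳ (seq (diagC p n k 0 i i) m)) (sym (cong-seq m (diagC-offDiagonal k l i j i≢j))))
    ... | yes refl with half n i
    ...   | upper a = trans (cong₂ _*_ (cong-seq m (diagC-upper k 0 a)) (cong-seq m (diagC-upper 0 l a)))
      (trans (ℤP.*-identityʳ (pow p k)) (sym (cong-seq m (diagC-upper k l a))))
    ...   | lower a = trans (cong₂ _*_ (cong-seq m (diagC-lower k 0 a)) (cong-seq m (diagC-lower 0 l a)))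
      (trans (ℤP.*-identityˡ (pow p l)) (sym (cong-seq m (diagC-lower k l a))))

  diagC-symplectic : ∀ α β →
    ((diagC p n α β ᵀ) ·M (J n ·M diagC p n α β)) ≈M (p^ (α ℕ.+ β) ⋆M J n)
  diagC-symplectic α β i j =
    ≈-from-seq {x = ((D ᵀ) ·M (J n ·M D)) i j} {y = (p^ (α ℕ.+ β) ⋆M J n) i j}
    (λ m → trans (ᵀ·M·M-at D (J n) D m i j)
      (trans (⊙-diagonalˡ (ᵀℤ-diagonal (diagC-at-diagonal α β m)) (J n at m ⊙ D at m) i j)
        (trans (cong (seq (D i i) m *_) (⊙-diagonalʳ (diagC-at-diagonal α β m) (J n at m) i j))
          (entry m))))
    where
    D = diagC p n α β
    within-block : ∀ {z} d d′ → z ≡ 0ℤ → d * (z * d′) ≡ pow p (α ℕ.+ β) * z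
    within-block d d′ refl = trans (cong (d *_) (ℤP.*-zeroˡ d′))
      (trans (ℤP.*-zeroʳ d) (sym (ℤP.*-zeroʳ (pow p (α ℕ.+ β)))))
    across-blocks : ∀ z d d′ → d * d′ ≡ pow p α * pow p β →
      d * (z * d′) ≡ pow p (α ℕ.+ β) * z
    across-blocks z d d′ dd′≡ = begin
      d * (z * d′)              ≡⟨ rearrange d z d′ ⟩
      d * d′ * z                ≡⟨ cong (_* z) (trans dd′≡ (sym (pow-+ α β))) ⟩
      pow p (α ℕ.+ β) * z       ∎
      where
      open ≡-Reasoning
      rearrange : ∀ x y z → x * (y * z) ≡ x * z * y
      rearrange = solve-∀
    entry : ∀ m → seq (D i i) m * (seq (J n i j) m * seq (D j j) m)
                ≡ seq (p^ (α ℕ.+ β)) m * seq (J n i j) m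
    entry m with half n i | half n j
    ... | upper a | upper b = within-block (seq (D (a ↑ˡ n) (a ↑ˡ n)) m)
      (seq (D (b ↑ˡ n) (b ↑ˡ n)) m) (cong-seq m (J-upper-upper a b))
    ... | lower a | lower b = within-block (seq (D (n ↑ʳ a) (n ↑ʳ a)) m)
      (seq (D (n ↑ʳ b) (n ↑ʳ b)) m) (cong-seq m (J-lower-lower a b))
    ... | upper a | lower b = across-blocks (seq (J n (a ↑ˡ n) (n ↑ʳ b)) m)
      (seq (D (a ↑ˡ n) (a ↑ˡ n)) m) (seq (D (n ↑ʳ b) (n ↑ʳ b)) m)
      (cong₂ _*_ (cong-seq m (diagC-upper α β a)) (cong-seq m (diagC-lower α β b)))
    ... | lower a | upper b = across-blocks (seq (J n (n ↑ʳ a) (b ↑ˡ n)) m)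
      (seq (D (n ↑ʳ a) (n ↑ʳ a)) m) (seq (D (b ↑ˡ n) (b ↑ˡ n)) m)
      (trans (cong₂ _*_ (cong-seq m (diagC-lower α β a)) (cong-seq m (diagC-upper α β b)))
             (ℤP.*-comm (pow p β) (pow p α)))

  diagC-column : ∀ k l (c₂ : Col p n) →
    ((diagC p n k 0 ·v colC p n c₂) +v (p^ l ⋆v (λ _ → 0p))) ≈v colC p n c₂
  diagC-column k l c₂ i = ≈-from-seq {x = ((D ·v c) +v (p^ l ⋆v (λ _ → 0p))) i} {y = c i} (λ m → begin
    seq ((D ·v c) i) m + pow p l * 0ℤ
      ≡⟨ cong (λ v → seq ((D ·v c) i) m + v) (ℤP.*-zeroʳ (pow p l)) ⟩
    seq ((D ·v c) i) m + 0ℤ             ≡⟨ ℤP.+-identityʳ _ ⟩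
    seq ((D ·v c) i) m                  ≡⟨ seq-Σp (λ t → D i t *p c t) m ⟩
    ∑[ t < n ℕ.+ n ] (seq (D i t) m * seq (c t) m)
      ≡⟨ sum-δ _ i (λ t t≢i → trans (cong (_* seq (c t) m) (diagC-at-diagonal k 0 m i t (t≢i ∘′ sym)))
                                   (ℤP.*-zeroˡ (seq (c t) m))) ⟩
    seq (D i i) m * seq (c i) m         ≡⟨ entry m ⟩
    seq (c i) m                         ∎)
    where
    open ≡-Reasoning
    D = diagC p n k 0
    c = colC p n c₂
    entry : ∀ m → seq (D i i) m * seq (c i) m ≡ seq (c i) m
    entry m with half n i
    ... | upper a = trans (cong (seq (D (a ↑ˡ n) (a ↑ˡ n)) m *_) (cong-seq m (colC-upper c₂ a)))
      (trans (ℤP.*-zeroʳ (seq (D (a ↑ˡ n) (a ↑ˡ n)) m)) (sym (cong-seq m (colC-upper c₂ a))))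
    ... | lower a = trans (cong (_* seq (c (n ↑ʳ a)) m) (cong-seq m (diagC-lower k 0 a)))
      (ℤP.*-identityˡ _)

  inProd-diagC : .{{_ : ℕ.NonTrivial p}} → ∀ k l (c₂ : Col p n) →
    InProd p n k l (diagC p n k l) (colC p n c₂)
  inProd-diagC k l c₂ = x , y , diagC-product k l , diagC-column k l c₂
    where
    x : Δ̃ p n k
    x = mkΔ̃ (diagC p n k 0) (p^ k) (λ _ → 0p)
      (subst (λ e → ((diagC p n k 0 ᵀ) ·M (J n ·M diagC p n k 0)) ≈M (p^ e ⋆M J n))
             (ℕP.+-identityʳ k) (diagC-symplectic k 0))
      (p^-hasVal k)
    y : Δ̃ p n l
    y = mkΔ̃ (diagC p n 0 l) (p^ l) (colC p n c₂) (diagC-symplectic 0 l) (p^-hasVal l)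

  isotropic-mod : ∀ {l} (x : Δ̃ p n l) {m} → m ≤ l → ∀ s t →
    pow p m ∣ ((mat x at m) ᵀℤ ⊙ (J n at m ⊙ mat x at m)) s t
  isotropic-mod x {m} m≤l s t = ∣-resp-≡mod
    (subst (λ v → v ≡ seq (mult x) m * seq (J n s t) m mod pow p m)
           (ᵀ·M·M-at (mat x) (J n) (mat x) m s t) (congruent (sympl x s t m)))
    (∣m⇒∣m*n (seq (J n s t) m) (∈p^⇒∣ {x = mult x} m (proj₁ (val x)) m≤l ℕP.≤-refl))

  lowerRows-divisible : .{{_ : NonZero p}} → ∀ {k l} → k < l →
    (x : Δ̃ p n l) (B : Mat p (n ℕ.+ n)) → (mat x ·M B) ≈M diagC p n k l →
    ∀ b i → + p ∣ seq (mat x (n ↑ʳ b) i) (suc k)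
  lowerRows-divisible {k} {l} k<l x B AB≈C b i =
    *-cancelˡ-∣ (pow p k) {{ℕP.m^n≢0 p k}} p^k·p∣p^k·Ā
    where
    K = suc k
    Ā = mat x at K
    B̄ = B at K
    J̄ = J n at K
    C̄ = diagC p n k l at K
    j = b ↑ˡ n
    r = n ↑ʳ b
    AB≡C : ∀ s t → (Ā ⊙ B̄) s t ≡ C̄ s t mod pow p K
    AB≡C s t =
      subst (λ v → v ≡ C̄ s t mod pow p K) (·M-at (mat x) B K s t) (congruent (AB≈C s t K))
    reassociate : ∀ s t → ((Ā ᵀℤ ⊙ (J̄ ⊙ Ā)) ⊙ B̄) s t ≡ (Ā ᵀℤ ⊙ (J̄ ⊙ (Ā ⊙ B̄))) s t
    reassociate s t = trans (⊙-assoc (Ā ᵀℤ) (J̄ ⊙ Ā) B̄ s t)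
      (sum-cong-≗ (λ u → cong (Ā u s *_) (⊙-assoc J̄ Ā B̄ u t)))
    ᵗĀJ̄C̄-divisible : ∀ s t → pow p K ∣ (Ā ᵀℤ ⊙ (J̄ ⊙ C̄)) s t
    ᵗĀJ̄C̄-divisible s t = ∣-resp-≡mod
      (⊙-congʳ-mod (Ā ᵀℤ) (⊙-congʳ-mod J̄ (λ u v → ≡mod-sym (AB≡C u v))) s t)
      (subst (pow p K ∣_) (reassociate s t)
        (∣-sum (λ u → ∣m⇒∣m*n (B̄ u t) (isotropic-mod x k<l s u))))
    J̄C̄-column : ∀ s → (J̄ ⊙ C̄) s j ≡ J̄ s j * pow p k
    J̄C̄-column s = trans (⊙-diagonalʳ (diagC-at-diagonal k l K) J̄ s j)
                        (cong (J̄ s j *_) (cong-seq K (diagC-upper k l b)))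
    J̄C̄-column-sparse : ∀ s → s ≢ r → (J̄ ⊙ C̄) s j ≡ 0ℤ
    J̄C̄-column-sparse s s≢r = trans (J̄C̄-column s)
      (trans (cong (_* pow p k) (cong-seq K (J-column-upper b s s≢r))) (ℤP.*-zeroˡ (pow p k)))
    ᵗĀJ̄C̄-entry : (Ā ᵀℤ ⊙ (J̄ ⊙ C̄)) i j ≡ - (pow p k * Ā r i)
    ᵗĀJ̄C̄-entry = begin
      (Ā ᵀℤ ⊙ (J̄ ⊙ C̄)) i j     ≡⟨ ⊙-sparseʳ (Ā ᵀℤ) (J̄ ⊙ C̄) J̄C̄-column-sparse i ⟩
      Ā r i * (J̄ ⊙ C̄) r j      ≡⟨ cong (Ā r i *_) (J̄C̄-column r) ⟩
      Ā r i * (J̄ r j * pow p k)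
        ≡⟨ cong (λ v → Ā r i * (v * pow p k)) (cong-seq K (J-lower-upper b)) ⟩
      Ā r i * (- + 1 * pow p k) ≡⟨ rearrange (Ā r i) (pow p k) ⟩
      - (pow p k * Ā r i)       ∎
      where
      open ≡-Reasoning
      rearrange : ∀ x y → x * (- + 1 * y) ≡ - (y * x)
      rearrange = solve-∀
    p^k·p∣p^k·Ā : pow p k * + p ∣ pow p k * Ā r i
    p^k·p∣p^k·Ā = subst₂ _∣_ (pow-suc k) (ℤP.neg-involutive _)
      (∣m⇒∣-m (subst (pow p K ∣_) ᵗĀJ̄C̄-entry (ᵗĀJ̄C̄-divisible i j)))

  not-inProd-diagC : .{{_ : NonZero p}} → ∀ {k l} → 1 ≤ k → k < l → (c₂ : Col p n) →
    ¬ (∀ b → c₂ b ∈p^ 1 ℤp) → ¬ InProd p n l k (diagC p n k l) (colC p n c₂)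
  not-inProd-diagC {k} 1≤k k<l c₂ c₂∉pℤp (x , y , AB≈C , v≈c) =
    c₂∉pℤp (λ b → ∈pℤp-from-level (c₂ b) k (p∣c₂ b))
    where
    K = suc k
    p∣μy : + p ∣ seq (mult y) K
    p∣μy = subst (_∣ seq (mult y) K) (cong +_ (ℕP.*-identityʳ p))
      (∈p^⇒∣ {x = mult y} K (proj₁ (val y)) 1≤k (ℕ.s≤s ℕ.z≤n))
    p∣Ā : ∀ b i → + p ∣ seq (mat x (n ↑ʳ b) i) K
    p∣Ā = lowerRows-divisible k<l x (mat y) AB≈C
    p∣c₂ : ∀ b → + p ∣ seq (c₂ b) K
    p∣c₂ b = ∣-resp-≡mod
      (≡mod-weaken (divides (pow p k) (pow-suc k))
        (≡mod-sym (≡mod-trans (congruent (v≈c r K)) (≡⇒≡mod (cong-seq K (colC-lower c₂ b))))))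
      (∣m∣n⇒∣m+n (subst (+ p ∣_) (sym (seq-Σp (λ t → mat x r t *p vec y t) K))
                   (∣-sum (λ t → ∣m⇒∣m*n (seq (vec y t) K) (p∣Ā b t))))
                 (∣m⇒∣m*n (seq (vec x r) K) p∣μy))
      where
      r = n ↑ʳ b

lemma4p5 : (p : ℕ) → Prime p → (n : ℕ) → 1 ≤ n → (k l : ℕ) → 1 ≤ k → k < l →
    (c₂ : Col p n) → ¬ (∀ (i : Fin n) → c₂ i ∈p^ 1 ℤp) →
    InProd p n k l (diagC p n k l) (colC p n c₂)
      × ¬ InProd p n l k (diagC p n k l) (colC p n c₂)
lemma4p5 p p-prime n _ k l 1≤k k<l c₂ c₂∉pℤp =
  inProd-diagC {{prime⇒nonTrivial p-prime}} k l c₂ ,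
  not-inProd-diagC {{prime⇒nonZero p-prime}} 1≤k k<l c₂ c₂∉pℤp
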